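{- Let $n$ be odd and let $f:\mathbb{F}_{2^n}\to\mathbb{F}_{2^n}$ be almost bent. Set \[N_0=|\{b\in\mathbb{F}_{2^n}^*: W_f(b,0)=0\}|,\quad N_+=|\{b\in\mathbb{F}_{2^n}^*: W_f(b,0)=2^{(n+1)/2}\}|,\quad N_-=|\{b\in\mathbb{F}_{2^n}^*: W_f(b,0)=-2^{(n+1)/2}\}|.\] Then \[N_0=2^n-1+2^{n-1}-N(f)/2,\] \[N_+=N(f)/4-2^{n-2}+2^{(n-3)/2}(\omega(0)-1),\] \[N_-=N(f)/4-2^{n-2}-2^{(n-3)/2}(\omega(0)-1).\]
   Context: $\mathrm{Tr}$ is the absolute trace $\mathbb{F}_{2^n}\to\mathbb{F}_2$ and $W_f(b,a)=\sum_{x\in\mathbb{F}_{2^n}}(-1)^{\mathrm{Tr}(bf(x)+ax)}$. For $n$ odd, $f$ is almost bent if $W_f(b,a)\in\{0,\pm2^{(n+1)/2}\}$ for all $b\in\mathbb{F}_{2^n}^*$, $a\in\mathbb{F}_{2^n}$. $N(f)$ is the number of pairs $(x,y)\in\mathbb{F}_{2^n}^2$ with $f(x)=f(y)$, and $\omega(0)=|f^{ -1}(\{0\})|$. -}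

module Defs where

open import Data.Bool using (Bool; true; false; if_then_else_; _xor_)
import Data.Bool as B
open import Data.Nat as ℕ using (ℕ; zero; suc)
open import Data.Integer as ℤ using (ℤ; +_; -_; _+_)
open import Data.List using (List; []; _∷_; map; _++_; filter; length; foldr)
open import Data.Vec as V using (Vec; []; _∷_; zipWith; replicate; toList)
import Data.Vec.Properties as VP
open import Data.Product using (_×_; _,_)
open import Data.Sum using (_⊎_)
open import Relation.Nullary using (Dec; ¬?; yes; no)
open import Relation.Binary.PropositionalEquality using (_≡_; _≢_)

-- Model of F_{2^n}: F_2[x]/(m(x)) with m(x) = x^n + Σ_{i<n} p_i x^i monic of
-- degree n.  An element is its coefficient vector (index i = coeff of x^i).
-- The modulus is given by its low coefficient vector p : Vec Bool n.
Elt : ℕ → Set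
Elt n = Vec Bool n

_≟E_ : ∀ {n} (a b : Elt n) → Dec (a ≡ b)
_≟E_ = VP.≡-dec B._≟_

0E : ∀ {n} → Elt n
0E = replicate _ false

1E : ∀ {n} → Elt n
1E {zero} = []
1E {suc n} = true ∷ replicate _ false

_⊕_ : ∀ {n} → Elt n → Elt n → Elt n
_⊕_ = zipWith _xor_

mulX : ∀ {n} → Vec Bool n → Elt n → Elt n
mulX {zero} p a = []
mulX {suc n} p a = if V.last a then (false ∷ V.init a) ⊕ p else (false ∷ V.init a)

horner : ∀ {n} → Vec Bool n → List Bool → Elt n → Elt n
horner p [] b = 0E
horner p (c ∷ cs) b = (if c then b else 0E) ⊕ mulX p (horner p cs b)

mul : ∀ {n} → Vec Bool n → Elt n → Elt n → Elt n
mul p a b = horner p (toList a) b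

-- the quotient ring is a field (i.e. m(x) irreducible, so it is F_{2^n})
IsField : ∀ {n} → Vec Bool n → Set
IsField {n} p = (1E {n} ≢ 0E) × (∀ (a : Elt n) → a ≢ 0E → Data.Product.Σ (Elt n) (λ b → mul p a b ≡ 1E))
  where import Data.Product

allElts : (n : ℕ) → List (Elt n)
allElts zero = [] ∷ []
allElts (suc n) = map (false ∷_) (allElts n) ++ map (true ∷_) (allElts n)

nonzeroElts : (n : ℕ) → List (Elt n)
nonzeroElts n = filter (λ a → ¬? (a ≟E 0E)) (allElts n)

trAux : ∀ {n} → Vec Bool n → ℕ → Elt n → Elt n
trAux p zero y = 0E
trAux p (suc i) y = y ⊕ trAux p i (mul p y y)

Tr : ∀ {n} → Vec Bool n → Elt n → Elt n
Tr {n} p x = trAux p n x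

sgnTr : ∀ {n} → Vec Bool n → Elt n → ℤ
sgnTr p y with Tr p y ≟E 0E
... | yes _ = + 1
... | no _ = - (+ 1)

sumℤ : List ℤ → ℤ
sumℤ = foldr _+_ (+ 0)

W : ∀ {n} → Vec Bool n → (Elt n → Elt n) → Elt n → Elt n → ℤ
W {n} p f b a = sumℤ (map (λ x → sgnTr p (mul p b (f x) ⊕ mul p a x)) (allElts n))

AlmostBent : (k : ℕ) (p : Vec Bool (suc (2 ℕ.* k))) → (Elt (suc (2 ℕ.* k)) → Elt (suc (2 ℕ.* k))) → Set
AlmostBent k p f = ∀ b → b ≢ 0E → ∀ a →
  (W p f b a ≡ + 0) ⊎ ((W p f b a ≡ + (2 ℕ.^ suc k)) ⊎ (W p f b a ≡ - (+ (2 ℕ.^ suc k))))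

Nf : ∀ {n} → (Elt n → Elt n) → ℕ
Nf {n} f = length (Data.List.concatMap (λ x → filter (λ y → f x ≟E f y) (allElts n)) (allElts n))
  where import Data.List

ω0 : ∀ {n} → (Elt n → Elt n) → ℕ
ω0 {n} f = length (filter (λ x → f x ≟E 0E) (allElts n))

countW : ∀ {n} → Vec Bool n → (Elt n → Elt n) → ℤ → ℕ
countW {n} p f v = length (filter (λ b → W p f b 0E ℤ.≟ v) (nonzeroElts n))

-- Let S(b) = W_f(b,0) and let a₀, a₊, a₋ count the nonzero b with S(b) = 0, 2^((n+1)/2),
-- -2^((n+1)/2). Orthogonality of the characters x ↦ (-1)^Tr(bx) gives the moments
-- Σ_b S(b) = 2^n ω(0) and Σ_b S(b)² = 2^n N(f). Removing the term b = 0, where S = 2^n,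
-- these two moments together with a₀ + a₊ + a₋ = 2^n - 1 are three linear equations that
-- determine the three counts. Orthogonality rests on Tr(1) = 1, which holds as n is odd, and on
-- Tr(x)² = Tr(x), which follows from x^(2^n) = x.

module Submission where

open import Defs
open import Algebra.Bundles using (AbelianGroup; CommutativeMonoid)
open import Algebra.Structures using (IsAbelianGroup; IsCommutativeMonoid)
import Algebra.Properties.AbelianGroup as AbelianGroupProperties
import Algebra.Properties.CommutativeSemigroup as CommutativeSemigroupProperties
import Algebra.Properties.Quasigroup as QuasigroupProperties
open import Data.Bool using (Bool; true; false; if_then_else_; _xor_)
open import Data.Bool.Properties using (xor-comm; xor-assoc; xor-same; xor-identityʳ)
open import Data.List as List using (List; []; _∷_; _++_; map; filter; length)
import Data.List.Properties as Listₚ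
open import Data.List.Relation.Unary.All as All using (All; []; _∷_)
import Data.List.Relation.Unary.All.Properties as All
open import Data.List.Relation.Unary.Any using (here; there)
open import Data.List.Relation.Unary.AllPairs using ([]; _∷_)
open import Data.List.Relation.Unary.Unique.Propositional using (Unique)
import Data.List.Relation.Unary.Unique.Propositional.Properties as Unique
open import Data.List.Membership.Propositional using (_∈_)
open import Data.List.Membership.Propositional.Properties
  using (∈-map⁺; ∈-map⁻; ∈-++⁺ˡ; ∈-++⁺ʳ; ∈-filter⁺; ∈-filter⁻)
open import Data.List.Membership.Propositional.Properties.WithK using (unique∧set⇒bag)
open import Data.List.Relation.Binary.BagAndSetEquality using (∼bag⇒↭)
open import Data.List.Relation.Binary.Permutation.Propositional using (_↭_; ↭⇒↭ₛ)
open import Data.List.Relation.Binary.Permutation.Setoid.Properties using (foldr-commMonoid)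
import Data.List.Relation.Binary.Permutation.Propositional.Properties as Perm
open import Data.Integer as ℤ using (ℤ; +_; -_; _+_; _-_; _*_)
import Data.Integer.Properties as ℤₚ
open import Data.Integer.Tactic.RingSolver using (solve-∀; solve)
open import Data.Nat as ℕ using (ℕ; zero; suc)
import Data.Nat.Properties as ℕₚ
open import Data.Product using (_×_; _,_; proj₁; proj₂; ∃₂)
open import Data.Sum using (_⊎_; inj₁; inj₂)
open import Data.Empty using (⊥-elim)
open import Data.Vec using (Vec; []; _∷_; _∷ʳ_; toList; initLast)
import Data.Vec.Properties as Vecₚ
open import Function.Bundles using (mk⇔)
open import Level using (0ℓ)
open import Relation.Nullary using (Dec; yes; no; ¬_; ¬?)
open import Relation.Binary.PropositionalEquality

⊕-self : ∀ {n} (a : Elt n) → a ⊕ a ≡ 0E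
⊕-self []      = refl
⊕-self (x ∷ a) = cong₂ _∷_ (xor-same x) (⊕-self a)

⊕-isAbelianGroup : ∀ {n} → IsAbelianGroup _≡_ (_⊕_ {n}) 0E (λ a → a)
⊕-isAbelianGroup = record
  { isGroup = record
    { isMonoid = record
      { isSemigroup = record
        { isMagma = record { isEquivalence = isEquivalence ; ∙-cong = cong₂ _⊕_ }
        ; assoc = Vecₚ.zipWith-assoc xor-assoc
        }
      ; identity = Vecₚ.zipWith-identityˡ (λ _ → refl) , Vecₚ.zipWith-identityʳ xor-identityʳ
      }
    ; inverse = ⊕-self , ⊕-self
    ; ⁻¹-cong = λ a≡b → a≡b
    }
  ; comm = Vecₚ.zipWith-comm xor-comm
  }

⊕-abelianGroup : ℕ → AbelianGroup 0ℓ 0ℓ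
⊕-abelianGroup n = record { isAbelianGroup = ⊕-isAbelianGroup {n} }

module _ {n : ℕ} where
  open IsAbelianGroup (⊕-isAbelianGroup {n}) public
    using () renaming (assoc to ⊕-assoc; comm to ⊕-comm; identityˡ to ⊕-identityˡ; identityʳ to ⊕-identityʳ)
  open AbelianGroupProperties (⊕-abelianGroup n) public
    using () renaming (x∙y⁻¹≈ε⇒x≈y to ⊕≡0⇒≡)
  open QuasigroupProperties (AbelianGroupProperties.quasigroup (⊕-abelianGroup n)) public
    using () renaming (cancelˡ to ⊕-cancelˡ)
  open CommutativeSemigroupProperties (AbelianGroup.commutativeSemigroup (⊕-abelianGroup n)) public
    using () renaming (interchange to ⊕-interchange)

scale : ∀ {n} → Bool → Elt n → Elt n
scale c a = if c then a else 0E

scale-xor : ∀ {n} c d (a : Elt n) → scale (c xor d) a ≡ scale c a ⊕ scale d a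
scale-xor false d     a = sym (⊕-identityˡ _)
scale-xor true  false a = sym (⊕-identityʳ a)
scale-xor true  true  a = sym (⊕-self a)

∷ʳ-⊕ : ∀ {n} (v w : Elt n) c d → (v ∷ʳ c) ⊕ (w ∷ʳ d) ≡ (v ⊕ w) ∷ʳ (c xor d)
∷ʳ-⊕ []      []      c d = refl
∷ʳ-⊕ (x ∷ v) (y ∷ w) c d = cong ((x xor y) ∷_) (∷ʳ-⊕ v w c d)

Additive : ∀ {n} → (Elt n → Elt n) → Set
Additive h = ∀ a b → h (a ⊕ b) ≡ h a ⊕ h b

scale-additive : ∀ {n} c → Additive (scale {n} c)
scale-additive false a b = sym (⊕-identityˡ 0E)
scale-additive true  a b = refl

module _ {n : ℕ} {h : Elt n → Elt n} (h-additive : Additive h) where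

  additive-0E : h 0E ≡ 0E
  additive-0E = begin
    h 0E           ≡⟨ cong h (sym (⊕-self 0E)) ⟩
    h (0E ⊕ 0E)    ≡⟨ h-additive 0E 0E ⟩
    h 0E ⊕ h 0E    ≡⟨ ⊕-self (h 0E) ⟩
    0E             ∎
    where open ≡-Reasoning

  additive-scale : ∀ c a → h (scale c a) ≡ scale c (h a)
  additive-scale false a = additive-0E
  additive-scale true  a = refl

allFalse⇒0E : ∀ {n} (w : Elt n) → All (_≡ false) (toList w) → w ≡ 0E
allFalse⇒0E []      []             = refl
allFalse⇒0E (x ∷ w) (refl ∷ w-false) = cong (false ∷_) (allFalse⇒0E w w-false)

module PolynomialMultiplication {m : ℕ} (p : Vec Bool (suc m)) where

  private
    F : Set
    F = Elt (suc m)

  mulX-∷ʳ : ∀ (w : Elt m) c → mulX p (w ∷ʳ c) ≡ (false ∷ w) ⊕ scale c p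
  mulX-∷ʳ w false rewrite Vecₚ.last-∷ʳ false w | Vecₚ.init-∷ʳ false w = sym (⊕-identityʳ _)
  mulX-∷ʳ w true  rewrite Vecₚ.last-∷ʳ true w  | Vecₚ.init-∷ʳ true w  = refl

  mulX-additive : Additive (mulX p)
  mulX-additive a b = additive-∷ʳ (initLast a) (initLast b)
    where
    open ≡-Reasoning
    additive-∷ʳ : ∃₂ (λ v c → a ≡ v ∷ʳ c) → ∃₂ (λ w d → b ≡ w ∷ʳ d) → mulX p (a ⊕ b) ≡ mulX p a ⊕ mulX p b
    additive-∷ʳ (v , c , refl) (w , d , refl) = begin
      mulX p ((v ∷ʳ c) ⊕ (w ∷ʳ d))                          ≡⟨ cong (mulX p) (∷ʳ-⊕ v w c d) ⟩
      mulX p ((v ⊕ w) ∷ʳ (c xor d))                          ≡⟨ mulX-∷ʳ (v ⊕ w) (c xor d) ⟩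
      (false ∷ (v ⊕ w)) ⊕ scale (c xor d) p                  ≡⟨ cong ((false ∷ (v ⊕ w)) ⊕_) (scale-xor c d p) ⟩
      ((false ∷ v) ⊕ (false ∷ w)) ⊕ (scale c p ⊕ scale d p) ≡⟨ ⊕-interchange _ _ _ _ ⟩
      ((false ∷ v) ⊕ scale c p) ⊕ ((false ∷ w) ⊕ scale d p) ≡⟨ sym (cong₂ _⊕_ (mulX-∷ʳ v c) (mulX-∷ʳ w d)) ⟩
      mulX p (v ∷ʳ c) ⊕ mulX p (w ∷ʳ d)                      ∎

  horner-additive : ∀ cs → Additive (horner p cs)
  horner-additive []       a b = sym (⊕-identityˡ 0E)
  horner-additive (c ∷ cs) a b = begin
    scale c (a ⊕ b) ⊕ mulX p (horner p cs (a ⊕ b))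
      ≡⟨ cong₂ _⊕_ (scale-additive c a b) (trans (cong (mulX p) (horner-additive cs a b)) (mulX-additive _ _)) ⟩
    (scale c a ⊕ scale c b) ⊕ (mulX p (horner p cs a) ⊕ mulX p (horner p cs b))
      ≡⟨ ⊕-interchange _ _ _ _ ⟩
    (scale c a ⊕ mulX p (horner p cs a)) ⊕ (scale c b ⊕ mulX p (horner p cs b))
      ∎
    where
    open ≡-Reasoning

  horner-mulX : ∀ cs b → horner p cs (mulX p b) ≡ mulX p (horner p cs b)
  horner-mulX []       b = sym (additive-0E mulX-additive)
  horner-mulX (c ∷ cs) b = begin
    scale c (mulX p b) ⊕ mulX p (horner p cs (mulX p b))
      ≡⟨ cong₂ _⊕_ (sym (additive-scale mulX-additive c b)) (cong (mulX p) (horner-mulX cs b)) ⟩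
    mulX p (scale c b) ⊕ mulX p (mulX p (horner p cs b))
      ≡⟨ sym (mulX-additive _ _) ⟩
    mulX p (scale c b ⊕ mulX p (horner p cs b))
      ∎
    where open ≡-Reasoning

  -- Every horner p cs is a polynomial in the additive map mulX p, so any two commute.
  horner-comm : ∀ cs ds b → horner p cs (horner p ds b) ≡ horner p ds (horner p cs b)
  horner-comm []       ds b = sym (additive-0E (horner-additive ds))
  horner-comm (c ∷ cs) ds b = begin
    scale c (horner p ds b) ⊕ mulX p (horner p cs (horner p ds b))
      ≡⟨ cong₂ _⊕_ (sym (additive-scale (horner-additive ds) c b)) (cong (mulX p) (horner-comm cs ds b)) ⟩
    horner p ds (scale c b) ⊕ mulX p (horner p ds (horner p cs b))
      ≡⟨ cong (horner p ds (scale c b) ⊕_) (sym (horner-mulX ds _)) ⟩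
    horner p ds (scale c b) ⊕ horner p ds (mulX p (horner p cs b))
      ≡⟨ sym (horner-additive ds _ _) ⟩
    horner p ds (scale c b ⊕ mulX p (horner p cs b))
      ∎
    where open ≡-Reasoning

  -- Generalised over trailing zeros so that the induction on cs goes through:
  -- below degree suc m multiplication by x never reduces modulo p.
  horner-one : ∀ cs {zs} (w : F) → All (_≡ false) zs → toList w ≡ cs ++ zs → horner p cs 1E ≡ w
  horner-one []       w       zs-false eq = sym (allFalse⇒0E w (subst (All (_≡ false)) (sym eq) zs-false))
  horner-one (c ∷ cs) {zs} (x ∷ w) zs-false eq with Listₚ.∷-injective eq
  ... | refl , eq′ = begin
    scale c 1E ⊕ mulX p (horner p cs 1E) ≡⟨ cong (λ t → scale c 1E ⊕ mulX p t) shifted ⟩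
    scale c 1E ⊕ mulX p (w ∷ʳ false)     ≡⟨ cong (scale c 1E ⊕_) (trans (mulX-∷ʳ w false) (⊕-identityʳ _)) ⟩
    scale c 1E ⊕ (false ∷ w)             ≡⟨ lowest-coefficient c ⟩
    c ∷ w                                ∎
    where
    open ≡-Reasoning
    padded : toList (w ∷ʳ false) ≡ cs ++ (zs ++ false ∷ [])
    padded = begin
      toList (w ∷ʳ false)      ≡⟨ Vecₚ.toList-∷ʳ false w ⟩
      toList w ++ false ∷ []   ≡⟨ cong (_++ false ∷ []) eq′ ⟩
      (cs ++ zs) ++ false ∷ [] ≡⟨ Listₚ.++-assoc cs zs _ ⟩
      cs ++ (zs ++ false ∷ []) ∎
    shifted : horner p cs 1E ≡ w ∷ʳ false
    shifted = horner-one cs (w ∷ʳ false) (All.++⁺ zs-false (refl ∷ [])) padded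
    lowest-coefficient : ∀ c → scale c 1E ⊕ (false ∷ w) ≡ c ∷ w
    lowest-coefficient false = ⊕-identityˡ _
    lowest-coefficient true  = cong (true ∷_) (⊕-identityˡ w)

  infixl 30 _·_
  _·_ : F → F → F
  a · b = mul p a b

  ·-identityʳ : ∀ a → a · 1E ≡ a
  ·-identityʳ a = horner-one (toList a) a [] (sym (Listₚ.++-identityʳ _))

  ·-comm : ∀ a b → a · b ≡ b · a
  ·-comm a b = begin
    horner p (toList a) b                         ≡⟨ cong (horner p (toList a)) (sym (·-identityʳ b)) ⟩
    horner p (toList a) (horner p (toList b) 1E)  ≡⟨ horner-comm (toList a) (toList b) 1E ⟩
    horner p (toList b) (horner p (toList a) 1E)  ≡⟨ cong (horner p (toList b)) (·-identityʳ a) ⟩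
    horner p (toList b) a                         ∎
    where open ≡-Reasoning

  ·-assoc : ∀ a b c → (a · b) · c ≡ a · (b · c)
  ·-assoc a b c = begin
    (a · b) · c  ≡⟨ ·-comm (a · b) c ⟩
    c · (a · b)  ≡⟨ horner-comm (toList c) (toList a) b ⟩
    a · (c · b)  ≡⟨ cong (a ·_) (·-comm c b) ⟩
    a · (b · c)  ∎
    where open ≡-Reasoning

  ·-identityˡ : ∀ a → 1E · a ≡ a
  ·-identityˡ a = trans (·-comm 1E a) (·-identityʳ a)

  ·-zeroʳ : ∀ a → a · 0E ≡ 0E
  ·-zeroʳ a = additive-0E (horner-additive (toList a))

  ·-zeroˡ : ∀ a → 0E · a ≡ 0E
  ·-zeroˡ a = trans (·-comm 0E a) (·-zeroʳ a)

  ·-distribˡ : ∀ a b c → a · (b ⊕ c) ≡ (a · b) ⊕ (a · c)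
  ·-distribˡ a = horner-additive (toList a)

  ·-distribʳ : ∀ a b c → (b ⊕ c) · a ≡ (b · a) ⊕ (c · a)
  ·-distribʳ a b c = begin
    (b ⊕ c) · a        ≡⟨ ·-comm (b ⊕ c) a ⟩
    a · (b ⊕ c)        ≡⟨ ·-distribˡ a b c ⟩
    (a · b) ⊕ (a · c)  ≡⟨ cong₂ _⊕_ (·-comm a b) (·-comm a c) ⟩
    (b · a) ⊕ (c · a)  ∎
    where open ≡-Reasoning

  square-additive : Additive (λ z → z · z)
  square-additive u v = begin
    (u ⊕ v) · (u ⊕ v)                           ≡⟨ ·-distribʳ (u ⊕ v) u v ⟩
    (u · (u ⊕ v)) ⊕ (v · (u ⊕ v))               ≡⟨ cong₂ _⊕_ (·-distribˡ u u v) (·-distribˡ v u v) ⟩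
    ((u · u) ⊕ (u · v)) ⊕ ((v · u) ⊕ (v · v))   ≡⟨ cong (((u · u) ⊕ (u · v)) ⊕_) (⊕-comm (v · u) (v · v)) ⟩
    ((u · u) ⊕ (u · v)) ⊕ ((v · v) ⊕ (v · u))   ≡⟨ ⊕-interchange (u · u) (u · v) (v · v) (v · u) ⟩
    ((u · u) ⊕ (v · v)) ⊕ ((u · v) ⊕ (v · u))   ≡⟨ cong (λ t → ((u · u) ⊕ (v · v)) ⊕ ((u · v) ⊕ t)) (·-comm v u) ⟩
    ((u · u) ⊕ (v · v)) ⊕ ((u · v) ⊕ (u · v))   ≡⟨ cong (((u · u) ⊕ (v · v)) ⊕_) (⊕-self (u · v)) ⟩
    ((u · u) ⊕ (v · v)) ⊕ 0E                    ≡⟨ ⊕-identityʳ _ ⟩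
    (u · u) ⊕ (v · v)                           ∎
    where open ≡-Reasoning

  ·-isCommutativeMonoid : IsCommutativeMonoid _≡_ _·_ 1E
  ·-isCommutativeMonoid = record
    { isMonoid = record
      { isSemigroup = record
        { isMagma = record { isEquivalence = isEquivalence ; ∙-cong = cong₂ _·_ }
        ; assoc = ·-assoc
        }
      ; identity = ·-identityˡ , ·-identityʳ
      }
    ; comm = ·-comm
    }

  ·-commutativeMonoid : CommutativeMonoid 0ℓ 0ℓ
  ·-commutativeMonoid = record { isCommutativeMonoid = ·-isCommutativeMonoid }

  open CommutativeSemigroupProperties (CommutativeMonoid.commutativeSemigroup ·-commutativeMonoid)
    using () renaming (interchange to ·-interchange) public

  infixr 35 _^_
  _^_ : F → ℕ → F
  z ^ zero  = 1E
  z ^ suc e = z · z ^ e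

  ^-+ : ∀ z e f → z ^ (e ℕ.+ f) ≡ z ^ e · z ^ f
  ^-+ z zero    f = sym (·-identityˡ _)
  ^-+ z (suc e) f = trans (cong (z ·_) (^-+ z e f)) (sym (·-assoc z _ _))

  ^-distrib-· : ∀ z w e → (z · w) ^ e ≡ z ^ e · w ^ e
  ^-distrib-· z w zero    = sym (·-identityˡ 1E)
  ^-distrib-· z w (suc e) = trans (cong ((z · w) ·_) (^-distrib-· z w e)) (·-interchange z w _ _)

  trAux-additive : ∀ j → Additive (trAux p j)
  trAux-additive zero    u v = sym (⊕-identityˡ 0E)
  trAux-additive (suc j) u v = begin
    (u ⊕ v) ⊕ trAux p j ((u ⊕ v) · (u ⊕ v))             ≡⟨ cong (λ t → (u ⊕ v) ⊕ trAux p j t) (square-additive u v) ⟩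
    (u ⊕ v) ⊕ trAux p j ((u · u) ⊕ (v · v))             ≡⟨ cong ((u ⊕ v) ⊕_) (trAux-additive j _ _) ⟩
    (u ⊕ v) ⊕ (trAux p j (u · u) ⊕ trAux p j (v · v))   ≡⟨ ⊕-interchange u v _ _ ⟩
    (u ⊕ trAux p j (u · u)) ⊕ (v ⊕ trAux p j (v · v))   ∎
    where open ≡-Reasoning

  trAux-square : ∀ j z → trAux p j z · trAux p j z ≡ trAux p j (z · z)
  trAux-square zero    z = ·-zeroˡ 0E
  trAux-square (suc j) z = begin
    (z ⊕ trAux p j (z · z)) · (z ⊕ trAux p j (z · z))   ≡⟨ square-additive z _ ⟩
    (z · z) ⊕ (trAux p j (z · z) · trAux p j (z · z))   ≡⟨ cong ((z · z) ⊕_) (trAux-square j (z · z)) ⟩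
    (z · z) ⊕ trAux p j ((z · z) · (z · z))             ∎
    where open ≡-Reasoning

  trAux-suc : ∀ j z → trAux p (suc j) z ≡ trAux p j z ⊕ z ^ (2 ℕ.^ j)
  trAux-suc zero    z = trans (⊕-identityʳ z) (sym (trans (⊕-identityˡ _) (·-identityʳ z)))
  trAux-suc (suc j) z = begin
    z ⊕ trAux p (suc j) (z · z)                      ≡⟨ cong (z ⊕_) (trAux-suc j (z · z)) ⟩
    z ⊕ (trAux p j (z · z) ⊕ (z · z) ^ (2 ℕ.^ j))    ≡⟨ sym (⊕-assoc z _ _) ⟩
    (z ⊕ trAux p j (z · z)) ⊕ (z · z) ^ (2 ℕ.^ j)    ≡⟨ cong ((z ⊕ trAux p j (z · z)) ⊕_) square-^ ⟩
    (z ⊕ trAux p j (z · z)) ⊕ z ^ (2 ℕ.^ suc j)      ∎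
    where
    open ≡-Reasoning
    square-^ : (z · z) ^ (2 ℕ.^ j) ≡ z ^ (2 ℕ.^ suc j)
    square-^ = begin
      (z · z) ^ (2 ℕ.^ j)              ≡⟨ ^-distrib-· z z (2 ℕ.^ j) ⟩
      z ^ (2 ℕ.^ j) · z ^ (2 ℕ.^ j)    ≡⟨ sym (^-+ z (2 ℕ.^ j) _) ⟩
      z ^ (2 ℕ.^ j ℕ.+ 2 ℕ.^ j)        ≡⟨ cong (λ e → z ^ (2 ℕ.^ j ℕ.+ e)) (sym (ℕₚ.+-identityʳ _)) ⟩
      z ^ (2 ℕ.^ suc j)                ∎

  trAux-1E-odd : ∀ i → trAux p (suc (i ℕ.+ i)) 1E ≡ 1E
  trAux-1E-odd zero    = trans (cong (λ t → 1E ⊕ trAux p 0 t) (·-identityʳ 1E)) (⊕-identityʳ 1E)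
  trAux-1E-odd (suc i) rewrite ℕₚ.+-suc i i = begin
    1E ⊕ ((1E · 1E) ⊕ trAux p (suc (i ℕ.+ i)) ((1E · 1E) · (1E · 1E)))
      ≡⟨ cong (λ t → 1E ⊕ (t ⊕ trAux p (suc (i ℕ.+ i)) (t · t))) (·-identityʳ 1E) ⟩
    1E ⊕ (1E ⊕ trAux p (suc (i ℕ.+ i)) (1E · 1E))
      ≡⟨ cong (λ t → 1E ⊕ (1E ⊕ trAux p (suc (i ℕ.+ i)) t)) (·-identityʳ 1E) ⟩
    1E ⊕ (1E ⊕ trAux p (suc (i ℕ.+ i)) 1E)
      ≡⟨ sym (⊕-assoc 1E 1E _) ⟩
    (1E ⊕ 1E) ⊕ trAux p (suc (i ℕ.+ i)) 1E
      ≡⟨ cong₂ _⊕_ (⊕-self 1E) (trAux-1E-odd i) ⟩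
    0E ⊕ 1E
      ≡⟨ ⊕-identityˡ 1E ⟩
    1E
      ∎
    where open ≡-Reasoning

trace-1E-odd : ∀ k (p : Vec Bool (suc (2 ℕ.* k))) → Tr p 1E ≡ 1E
trace-1E-odd k p = subst (λ j → trAux p (suc j) 1E ≡ 1E) (cong (k ℕ.+_) (sym (ℕₚ.+-identityʳ k)))
                         (PolynomialMultiplication.trAux-1E-odd p k)

∑ : ∀ {A : Set} → List A → (A → ℤ) → ℤ
∑ xs h = sumℤ (map h xs)

infix 5 ∑
syntax ∑ xs (λ x → e) = ∑[ x ∈ xs ] e

x≡-x⇒x≡0 : ∀ x → x ≡ - x → x ≡ + 0
x≡-x⇒x≡0 x x≡-x = ℤₚ.*-cancelˡ-≡ (+ 2) x (+ 0) (begin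
  + 2 * x   ≡⟨ double x ⟩
  x + x     ≡⟨ cong (_+_ x) x≡-x ⟩
  x + - x   ≡⟨ ℤₚ.+-inverseʳ x ⟩
  + 0       ∎)
  where
  open ≡-Reasoning
  double : ∀ x → + 2 * x ≡ x + x
  double = solve-∀

-x≢0 : ∀ {x} → x ≢ + 0 → - x ≢ + 0
-x≢0 {x} x≢0 -x≡0 = x≢0 (trans (sym (ℤₚ.neg-involutive x)) (cong -_ -x≡0))

x≢-x : ∀ {x} → x ≢ + 0 → x ≢ - x
x≢-x {x} x≢0 x≡-x = x≢0 (x≡-x⇒x≡0 x x≡-x)

indicator : ∀ {B : Set} → Dec B → ℤ → ℤ
indicator (yes _) c = c
indicator (no _)  c = + 0

sumℤ-↭ : ∀ {xs ys : List ℤ} → xs ↭ ys → sumℤ xs ≡ sumℤ ys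
sumℤ-↭ xs↭ys = foldr-commMonoid (setoid ℤ) ℤₚ.+-0-isCommutativeMonoid (↭⇒↭ₛ xs↭ys)

module _ {A : Set} where

  ∑-permute : ∀ (σ : A → A) (h : A → ℤ) {xs} → map σ xs ↭ xs → ∑[ x ∈ xs ] h (σ x) ≡ ∑ xs h
  ∑-permute σ h {xs} σxs↭xs = trans (cong sumℤ (Listₚ.map-∘ xs)) (sumℤ-↭ (Perm.map⁺ h σxs↭xs))

  ∑-cong : ∀ {g h : A → ℤ} → (∀ x → g x ≡ h x) → ∀ xs → ∑ xs g ≡ ∑ xs h
  ∑-cong g≗h xs = cong sumℤ (Listₚ.map-cong g≗h xs)

  ∑-+ : ∀ (g h : A → ℤ) xs → ∑[ x ∈ xs ] (g x + h x) ≡ ∑ xs g + ∑ xs h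
  ∑-+ g h []       = refl
  ∑-+ g h (x ∷ xs) = trans (cong (_+_ (g x + h x)) (∑-+ g h xs)) (medial (g x) (h x) _ _)
    where
    medial : ∀ a b c d → a + b + (c + d) ≡ (a + c) + (b + d)
    medial = solve-∀

  *-∑ : ∀ c (h : A → ℤ) xs → c * ∑ xs h ≡ ∑[ x ∈ xs ] (c * h x)
  *-∑ c h []       = ℤₚ.*-zeroʳ c
  *-∑ c h (x ∷ xs) = trans (ℤₚ.*-distribˡ-+ c (h x) _) (cong (_+_ (c * h x)) (*-∑ c h xs))

  ∑-* : ∀ c (h : A → ℤ) xs → ∑ xs h * c ≡ ∑[ x ∈ xs ] (h x * c)
  ∑-* c h xs = trans (ℤₚ.*-comm _ c) (trans (*-∑ c h xs) (∑-cong (λ x → ℤₚ.*-comm c (h x)) xs))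

  ∑-neg : ∀ (h : A → ℤ) xs → ∑[ x ∈ xs ] (- h x) ≡ - ∑ xs h
  ∑-neg h []       = refl
  ∑-neg h (x ∷ xs) = trans (cong (_+_ (- h x)) (∑-neg h xs)) (sym (ℤₚ.neg-distrib-+ (h x) _))

  ∑-one : ∀ (xs : List A) → ∑[ x ∈ xs ] + 1 ≡ + length xs
  ∑-one []       = refl
  ∑-one (x ∷ xs) = cong (_+_ (+ 1)) (∑-one xs)

  ∑-zero : ∀ (xs : List A) → ∑[ x ∈ xs ] + 0 ≡ + 0
  ∑-zero []       = refl
  ∑-zero (x ∷ xs) = trans (ℤₚ.+-identityˡ _) (∑-zero xs)

  ∑-indicator : ∀ {P : A → Set} (P? : ∀ x → Dec (P x)) c xs →
                ∑[ x ∈ xs ] indicator (P? x) c ≡ c * + length (filter P? xs)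
  ∑-indicator P? c []       = sym (ℤₚ.*-zeroʳ c)
  ∑-indicator P? c (x ∷ xs) with P? x
  ... | yes _ = trans (cong (_+_ c) (∑-indicator P? c xs)) (+-* c _)
    where
    +-* : ∀ c a → c + c * a ≡ c * (+ 1 + a)
    +-* = solve-∀
  ... | no _  = trans (ℤₚ.+-identityˡ _) (∑-indicator P? c xs)

module _ {A B : Set} where

  ∑-swap : ∀ (g : A → B → ℤ) xs ys → ∑[ x ∈ xs ] ∑ ys (g x) ≡ ∑[ y ∈ ys ] ∑[ x ∈ xs ] g x y
  ∑-swap g []       ys = sym (∑-zero ys)
  ∑-swap g (x ∷ xs) ys = trans (cong (_+_ (∑ ys (g x))) (∑-swap g xs ys)) (sym (∑-+ (g x) _ ys))

  length-concatMap : ∀ (h : A → List B) xs → + length (List.concatMap h xs) ≡ ∑[ x ∈ xs ] + length (h x)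
  length-concatMap h []       = refl
  length-concatMap h (x ∷ xs) = begin
    + length (h x ++ List.concatMap h xs)            ≡⟨ cong (+_) (Listₚ.length-++ (h x)) ⟩
    + (length (h x) ℕ.+ length (List.concatMap h xs)) ≡⟨ ℤₚ.pos-+ (length (h x)) _ ⟩
    + length (h x) + + length (List.concatMap h xs)   ≡⟨ cong (_+_ (+ length (h x))) (length-concatMap h xs) ⟩
    + length (h x) + (∑[ x ∈ xs ] + length (h x))     ∎
    where open ≡-Reasoning

module _ {A : Set} {xs : List A} (xs-unique : Unique xs) (σ τ : A → A)
         (τσ : ∀ x → τ (σ x) ≡ x) (στ : ∀ y → σ (τ y) ≡ y)
         (σ-closed : ∀ {x} → x ∈ xs → σ x ∈ xs) (τ-closed : ∀ {x} → x ∈ xs → τ x ∈ xs) where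

  map-inverse-↭ : map σ xs ↭ xs
  map-inverse-↭ = ∼bag⇒↭ (unique∧set⇒bag (Unique.map⁺ σ-injective xs-unique) xs-unique (mk⇔ to from))
    where
    σ-injective : ∀ {x y} → σ x ≡ σ y → x ≡ y
    σ-injective {x} {y} σx≡σy = trans (sym (τσ x)) (trans (cong τ σx≡σy) (τσ y))
    to : ∀ {y} → y ∈ map σ xs → y ∈ xs
    to y∈σxs with ∈-map⁻ σ y∈σxs
    ... | x , x∈xs , refl = σ-closed x∈xs
    from : ∀ {y} → y ∈ xs → y ∈ map σ xs
    from {y} y∈xs = subst (_∈ map σ xs) (στ y) (∈-map⁺ σ (τ-closed y∈xs))

allElts-complete : ∀ n (x : Elt n) → x ∈ allElts n
allElts-complete zero    []          = here refl
allElts-complete (suc n) (false ∷ x) = ∈-++⁺ˡ (∈-map⁺ (false ∷_) (allElts-complete n x))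
allElts-complete (suc n) (true ∷ x)  = ∈-++⁺ʳ (map (false ∷_) (allElts n)) (∈-map⁺ (true ∷_) (allElts-complete n x))

allElts-unique : ∀ n → Unique (allElts n)
allElts-unique zero    = [] ∷ []
allElts-unique (suc n) = Unique.++⁺ (Unique.map⁺ ∷-injectiveʳ (allElts-unique n))
                                    (Unique.map⁺ ∷-injectiveʳ (allElts-unique n)) disjoint
  where
  ∷-injectiveʳ : ∀ {b} {x y : Elt n} → b ∷ x ≡ b ∷ y → x ≡ y
  ∷-injectiveʳ refl = refl
  disjoint : ∀ {v} → ¬ (v ∈ map (false ∷_) (allElts n) × v ∈ map (true ∷_) (allElts n))
  disjoint (v∈false , v∈true) with ∈-map⁻ (false ∷_) v∈false | ∈-map⁻ (true ∷_) v∈true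
  ... | _ , _ , refl | _ , _ , ()

length-allElts : ∀ n → length (allElts n) ≡ 2 ℕ.^ n
length-allElts zero    = refl
length-allElts (suc n) = begin
  length (map (false ∷_) (allElts n) ++ map (true ∷_) (allElts n))  ≡⟨ Listₚ.length-++ (map (false ∷_) (allElts n)) ⟩
  length (map (false ∷_) (allElts n)) ℕ.+ length (map (true ∷_) (allElts n))
    ≡⟨ cong₂ ℕ._+_ (Listₚ.length-map _ (allElts n)) (Listₚ.length-map _ (allElts n)) ⟩
  length (allElts n) ℕ.+ length (allElts n)  ≡⟨ cong (λ l → l ℕ.+ l) (length-allElts n) ⟩
  2 ℕ.^ n ℕ.+ 2 ℕ.^ n                          ≡⟨ cong (2 ℕ.^ n ℕ.+_) (sym (ℕₚ.+-identityʳ _)) ⟩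
  2 ℕ.^ suc n                                  ∎
  where open ≡-Reasoning

module _ (n : ℕ) where

  ∈-nonzeroElts⁺ : ∀ {x : Elt n} → x ≢ 0E → x ∈ nonzeroElts n
  ∈-nonzeroElts⁺ {x} x≢0 = ∈-filter⁺ (λ a → ¬? (a ≟E 0E)) (allElts-complete n x) x≢0

  ∈-nonzeroElts⁻ : ∀ {x : Elt n} → x ∈ nonzeroElts n → x ≢ 0E
  ∈-nonzeroElts⁻ x∈ = proj₂ (∈-filter⁻ (λ a → ¬? (a ≟E 0E)) {xs = allElts n} x∈)

  nonzeroElts-unique : Unique (nonzeroElts n)
  nonzeroElts-unique = Unique.filter⁺ _ (allElts-unique n)

  allElts↭0E∷nonzeroElts : allElts n ↭ 0E ∷ nonzeroElts n
  allElts↭0E∷nonzeroElts =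
    ∼bag⇒↭ (unique∧set⇒bag (allElts-unique n) split-unique (λ {x} → mk⇔ to (λ _ → allElts-complete n x)))
    where
    split-unique : Unique (0E ∷ nonzeroElts n)
    split-unique = All.tabulate (λ x∈ 0≡x → ∈-nonzeroElts⁻ x∈ (sym 0≡x)) ∷ nonzeroElts-unique
    to : ∀ {x} → x ∈ allElts n → x ∈ 0E ∷ nonzeroElts n
    to {x} _ with x ≟E 0E
    ... | yes refl = here refl
    ... | no x≢0   = there (∈-nonzeroElts⁺ x≢0)

  ∑-1-allElts : ∑[ x ∈ allElts n ] + 1 ≡ + (2 ℕ.^ n)
  ∑-1-allElts = trans (∑-one (allElts n)) (cong +_ (length-allElts n))

  suc-length-nonzeroElts : suc (length (nonzeroElts n)) ≡ 2 ℕ.^ n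
  suc-length-nonzeroElts = trans (sym (Perm.↭-length allElts↭0E∷nonzeroElts)) (length-allElts n)

indicator-⊕≟0E : ∀ {n} (u v : Elt n) c → indicator ((u ⊕ v) ≟E 0E) c ≡ indicator (u ≟E v) c
indicator-⊕≟0E u v c with (u ⊕ v) ≟E 0E | u ≟E v
... | yes _     | yes _    = refl
... | yes u⊕v≡0 | no  u≢v  = ⊥-elim (u≢v (⊕≡0⇒≡ u v u⊕v≡0))
... | no  u⊕v≢0 | yes refl = ⊥-elim (u⊕v≢0 (⊕-self u))
... | no  _     | no  _    = refl

count : ∀ {A : Set} → (A → ℤ) → ℤ → List A → ℕ
count g v xs = length (filter (λ x → g x ℤ.≟ v) xs)

module _ {A : Set} (g : A → ℤ) (t : ℤ) where

  private
    count-≡ : ∀ {v x} xs → g x ≡ v → count g v (x ∷ xs) ≡ suc (count g v xs)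
    count-≡ {v} xs gx≡v = cong length (Listₚ.filter-accept (λ x → g x ℤ.≟ v) gx≡v)

    count-≢ : ∀ {v x} xs → g x ≢ v → count g v (x ∷ xs) ≡ count g v xs
    count-≢ {v} xs gx≢v = cong length (Listₚ.filter-reject (λ x → g x ℤ.≟ v) gx≢v)

  ThreeValued : List A → Set
  ThreeValued = All (λ x → g x ≡ + 0 ⊎ g x ≡ t ⊎ g x ≡ - t)

  three-valued-counts : t ≢ + 0 → ∀ xs → ThreeValued xs →
      length xs ≡ count g (+ 0) xs ℕ.+ count g t xs ℕ.+ count g (- t) xs
    × ∑ xs g ≡ t * (+ count g t xs - + count g (- t) xs)
    × ∑[ x ∈ xs ] g x * g x ≡ t * t * (+ count g t xs + + count g (- t) xs)
  three-valued-counts t≢0 [] [] = refl , sym (ℤₚ.*-zeroʳ t) , sym (ℤₚ.*-zeroʳ (t * t))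
  three-valued-counts t≢0 (x ∷ xs) (inj₁ gx≡0 ∷ rest)
    rewrite count-≡ xs gx≡0
          | count-≢ xs (λ gx≡t → t≢0 (trans (sym gx≡t) gx≡0))
          | count-≢ xs (λ gx≡-t → -x≢0 t≢0 (trans (sym gx≡-t) gx≡0))
          | gx≡0
    with three-valued-counts t≢0 xs rest
  ... | #xs , ∑g , ∑g² = cong suc #xs , trans (ℤₚ.+-identityˡ _) ∑g , trans (ℤₚ.+-identityˡ _) ∑g²
  three-valued-counts t≢0 (x ∷ xs) (inj₂ (inj₁ gx≡t) ∷ rest)
    rewrite count-≢ xs (λ gx≡0 → t≢0 (trans (sym gx≡t) gx≡0))
          | count-≡ xs gx≡t
          | count-≢ xs (λ gx≡-t → x≢-x t≢0 (trans (sym gx≡t) gx≡-t))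
          | gx≡t
    with three-valued-counts t≢0 xs rest
  ... | #xs , ∑g , ∑g² =
    trans (cong suc #xs) (sym (cong (ℕ._+ count g (- t) xs) (ℕₚ.+-suc (count g (+ 0) xs) _))) ,
    trans (cong (_+_ t) ∑g) (one-more t (+ count g t xs) (+ count g (- t) xs)) ,
    trans (cong (_+_ (t * t)) ∑g²) (one-more² t (+ count g t xs) (+ count g (- t) xs))
    where
    one-more : ∀ t a b → t + t * (a - b) ≡ t * ((+ 1 + a) - b)
    one-more = solve-∀
    one-more² : ∀ t a b → t * t + t * t * (a + b) ≡ t * t * ((+ 1 + a) + b)
    one-more² = solve-∀
  three-valued-counts t≢0 (x ∷ xs) (inj₂ (inj₂ gx≡-t) ∷ rest)
    rewrite count-≢ xs (λ gx≡0 → -x≢0 t≢0 (trans (sym gx≡-t) gx≡0))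
          | count-≢ xs (λ gx≡t → x≢-x t≢0 (sym (trans (sym gx≡-t) gx≡t)))
          | count-≡ xs gx≡-t
          | gx≡-t
    with three-valued-counts t≢0 xs rest
  ... | #xs , ∑g , ∑g² =
    trans (cong suc #xs) (sym (ℕₚ.+-suc _ (count g (- t) xs))) ,
    trans (cong (_+_ (- t)) ∑g) (one-less t (+ count g t xs) (+ count g (- t) xs)) ,
    trans (cong (_+_ (- t * - t)) ∑g²) (one-less² t (+ count g t xs) (+ count g (- t) xs))
    where
    one-less : ∀ t a b → - t + t * (a - b) ≡ t * (a - (+ 1 + b))
    one-less = solve-∀
    one-less² : ∀ t a b → - t * - t + t * t * (a + b) ≡ t * t * (a + (+ 1 + b))
    one-less² = solve-∀

module FiniteField {m : ℕ} (p : Vec Bool (suc m)) (isField : IsField p) where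

  open PolynomialMultiplication p

  private
    n : ℕ
    n = suc m
    F : Set
    F = Elt n

  1E≢0E : 1E {n} ≢ 0E
  1E≢0E = proj₁ isField

  ·≡0⇒≡0 : ∀ {a} b → a ≢ 0E → a · b ≡ 0E → b ≡ 0E
  ·≡0⇒≡0 {a} b a≢0 ab≡0 with proj₂ isField a a≢0
  ... | a⁻¹ , aa⁻¹≡1 = begin
    b              ≡⟨ sym (·-identityˡ b) ⟩
    1E · b         ≡⟨ cong (_· b) (trans (sym aa⁻¹≡1) (·-comm a a⁻¹)) ⟩
    (a⁻¹ · a) · b  ≡⟨ ·-assoc a⁻¹ a b ⟩
    a⁻¹ · (a · b)  ≡⟨ cong (a⁻¹ ·_) ab≡0 ⟩
    a⁻¹ · 0E       ≡⟨ ·-zeroʳ a⁻¹ ⟩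
    0E             ∎
    where open ≡-Reasoning

  ·-≢0 : ∀ {a b} → a ≢ 0E → b ≢ 0E → a · b ≢ 0E
  ·-≢0 {b = b} a≢0 b≢0 ab≡0 = b≢0 (·≡0⇒≡0 b a≢0 ab≡0)

  ·-cancelʳ : ∀ {c} a b → c ≢ 0E → a · c ≡ b · c → a ≡ b
  ·-cancelʳ {c} a b c≢0 ac≡bc = ⊕≡0⇒≡ a b (·≡0⇒≡0 (a ⊕ b) c≢0 (begin
    c · (a ⊕ b)          ≡⟨ ·-comm c (a ⊕ b) ⟩
    (a ⊕ b) · c          ≡⟨ ·-distribʳ c a b ⟩
    (a · c) ⊕ (b · c)    ≡⟨ cong (_⊕ (b · c)) ac≡bc ⟩
    (b · c) ⊕ (b · c)    ≡⟨ ⊕-self (b · c) ⟩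
    0E                   ∎))
    where open ≡-Reasoning

  module _ {a : F} (a≢0 : a ≢ 0E) where

    private
      a⁻¹ : F
      a⁻¹ = proj₁ (proj₂ isField a a≢0)
      aa⁻¹≡1 : a · a⁻¹ ≡ 1E
      aa⁻¹≡1 = proj₂ (proj₂ isField a a≢0)
      a⁻¹a≡1 : a⁻¹ · a ≡ 1E
      a⁻¹a≡1 = trans (·-comm a⁻¹ a) aa⁻¹≡1
      a⁻¹≢0 : a⁻¹ ≢ 0E
      a⁻¹≢0 a⁻¹≡0 = 1E≢0E (trans (sym a⁻¹a≡1) (trans (cong (_· a) a⁻¹≡0) (·-zeroˡ a)))
      a⁻¹·a· : ∀ x → a⁻¹ · (a · x) ≡ x
      a⁻¹·a· x = trans (sym (·-assoc a⁻¹ a x)) (trans (cong (_· x) a⁻¹a≡1) (·-identityˡ x))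
      a·a⁻¹· : ∀ x → a · (a⁻¹ · x) ≡ x
      a·a⁻¹· x = trans (sym (·-assoc a a⁻¹ x)) (trans (cong (_· x) aa⁻¹≡1) (·-identityˡ x))

    map-·-allElts↭ : map (a ·_) (allElts n) ↭ allElts n
    map-·-allElts↭ = map-inverse-↭ (allElts-unique n) (a ·_) (a⁻¹ ·_) a⁻¹·a· a·a⁻¹·
      (λ _ → allElts-complete n _) (λ _ → allElts-complete n _)

    map-·-nonzeroElts↭ : map (a ·_) (nonzeroElts n) ↭ nonzeroElts n
    map-·-nonzeroElts↭ = map-inverse-↭ (nonzeroElts-unique n) (a ·_) (a⁻¹ ·_) a⁻¹·a· a·a⁻¹·
      (λ x∈ → ∈-nonzeroElts⁺ n (·-≢0 a≢0 (∈-nonzeroElts⁻ n x∈)))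
      (λ x∈ → ∈-nonzeroElts⁺ n (·-≢0 a⁻¹≢0 (∈-nonzeroElts⁻ n x∈)))

  product : List F → F
  product = List.foldr _·_ 1E

  product-map-· : ∀ a xs → product (map (a ·_) xs) ≡ a ^ length xs · product xs
  product-map-· a []       = sym (·-identityˡ 1E)
  product-map-· a (x ∷ xs) = trans (cong ((a · x) ·_) (product-map-· a xs)) (·-interchange a x _ _)

  product-≢0 : ∀ {xs} → All (_≢ 0E) xs → product xs ≢ 0E
  product-≢0 []             = 1E≢0E
  product-≢0 (x≢0 ∷ xs≢0) = ·-≢0 x≢0 (product-≢0 xs≢0)

  -- Multiplication by a permutes the nonzero elements, so a ^ #F* times their
  -- product is that same product.
  ^-#nonzero≡1 : ∀ {a} → a ≢ 0E → a ^ length (nonzeroElts n) ≡ 1E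
  ^-#nonzero≡1 {a} a≢0 = ·-cancelʳ _ 1E (product-≢0 (All.tabulate (∈-nonzeroElts⁻ n))) (begin
    a ^ length (nonzeroElts n) · P   ≡⟨ sym (product-map-· a (nonzeroElts n)) ⟩
    product (map (a ·_) (nonzeroElts n))
      ≡⟨ foldr-commMonoid (setoid F) ·-isCommutativeMonoid (↭⇒↭ₛ (map-·-nonzeroElts↭ a≢0)) ⟩
    P                                ≡⟨ sym (·-identityˡ P) ⟩
    1E · P                           ∎)
    where
    open ≡-Reasoning
    P : F
    P = product (nonzeroElts n)

  ^-2^n : ∀ z → z ^ (2 ℕ.^ n) ≡ z
  ^-2^n z = begin
    z ^ (2 ℕ.^ n)                         ≡⟨ cong (z ^_) (sym (suc-length-nonzeroElts n)) ⟩
    z · z ^ length (nonzeroElts n)        ≡⟨ by-cases (z ≟E 0E) ⟩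
    z                                     ∎
    where
    open ≡-Reasoning
    by-cases : Dec (z ≡ 0E) → z · z ^ length (nonzeroElts n) ≡ z
    by-cases (yes refl) = ·-zeroˡ _
    by-cases (no z≢0)   = trans (cong (z ·_) (^-#nonzero≡1 z≢0)) (·-identityʳ z)

  trace-idempotent : ∀ z → Tr p z · Tr p z ≡ Tr p z
  trace-idempotent z = trans (trAux-square n z) (sym (⊕-cancelˡ z _ _ (begin
    z ⊕ trAux p n z                 ≡⟨ ⊕-comm z _ ⟩
    trAux p n z ⊕ z                 ≡⟨ cong (trAux p n z ⊕_) (sym (^-2^n z)) ⟩
    trAux p n z ⊕ z ^ (2 ℕ.^ n)     ≡⟨ sym (trAux-suc n z) ⟩
    z ⊕ trAux p n (z · z)           ∎)))
    where open ≡-Reasoning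

  trace-0E-or-1E : ∀ z → Tr p z ≡ 0E ⊎ Tr p z ≡ 1E
  trace-0E-or-1E z with Tr p z ≟E 0E
  ... | yes t≡0 = inj₁ t≡0
  ... | no  t≢0 = inj₂ (⊕≡0⇒≡ (Tr p z) 1E (·≡0⇒≡0 _ t≢0 (begin
    Tr p z · (Tr p z ⊕ 1E)                ≡⟨ ·-distribˡ (Tr p z) (Tr p z) 1E ⟩
    (Tr p z · Tr p z) ⊕ (Tr p z · 1E)     ≡⟨ cong₂ _⊕_ (trace-idempotent z) (·-identityʳ (Tr p z)) ⟩
    Tr p z ⊕ Tr p z                       ≡⟨ ⊕-self (Tr p z) ⟩
    0E                                    ∎)))
    where open ≡-Reasoning

  χ : F → ℤ
  χ = sgnTr p

  χ-trace-0E : ∀ {y} → Tr p y ≡ 0E → χ y ≡ + 1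
  χ-trace-0E {y} t≡0 with Tr p y ≟E 0E
  ... | yes _   = refl
  ... | no  t≢0 = ⊥-elim (t≢0 t≡0)

  χ-trace-1E : ∀ {y} → Tr p y ≡ 1E → χ y ≡ - + 1
  χ-trace-1E {y} t≡1 with Tr p y ≟E 0E
  ... | yes t≡0 = ⊥-elim (1E≢0E (trans (sym t≡1) t≡0))
  ... | no  _   = refl

  χ-0E : χ 0E ≡ + 1
  χ-0E = χ-trace-0E (additive-0E (trAux-additive n))

  private
    trace-⊕ : ∀ {u v s t r} → Tr p u ≡ s → Tr p v ≡ t → s ⊕ t ≡ r → Tr p (u ⊕ v) ≡ r
    trace-⊕ {u} {v} tu≡s tv≡t s⊕t≡r = trans (trAux-additive n u v) (trans (cong₂ _⊕_ tu≡s tv≡t) s⊕t≡r)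

  χ-⊕ : ∀ u v → χ (u ⊕ v) ≡ χ u * χ v
  χ-⊕ u v with trace-0E-or-1E u | trace-0E-or-1E v
  ... | inj₁ tu | inj₁ tv =
    trans (χ-trace-0E (trace-⊕ tu tv (⊕-identityˡ 0E))) (sym (cong₂ _*_ (χ-trace-0E tu) (χ-trace-0E tv)))
  ... | inj₁ tu | inj₂ tv =
    trans (χ-trace-1E (trace-⊕ tu tv (⊕-identityˡ 1E))) (sym (cong₂ _*_ (χ-trace-0E tu) (χ-trace-1E tv)))
  ... | inj₂ tu | inj₁ tv =
    trans (χ-trace-1E (trace-⊕ tu tv (⊕-identityʳ 1E))) (sym (cong₂ _*_ (χ-trace-1E tu) (χ-trace-0E tv)))
  ... | inj₂ tu | inj₂ tv =
    trans (χ-trace-0E (trace-⊕ tu tv (⊕-self 1E))) (sym (cong₂ _*_ (χ-trace-1E tu) (χ-trace-1E tv)))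

  -- The hypothesis Tr 1 = 1 (true for odd n) makes x ↦ x ⊕ 1 flip every sign of χ.
  module _ (trace-1E : Tr p 1E ≡ 1E) where

    ∑-χ : ∑ (allElts n) χ ≡ + 0
    ∑-χ = x≡-x⇒x≡0 _ (begin
      ∑ (allElts n) χ                        ≡⟨ sym (∑-permute (_⊕ 1E) χ ⊕1E-↭) ⟩
      ∑[ x ∈ allElts n ] χ (x ⊕ 1E)          ≡⟨ ∑-cong flip (allElts n) ⟩
      ∑[ x ∈ allElts n ] - χ x               ≡⟨ ∑-neg χ (allElts n) ⟩
      - ∑ (allElts n) χ                      ∎)
      where
      open ≡-Reasoning
      ⊕1⊕1 : ∀ x → (x ⊕ 1E) ⊕ 1E ≡ x
      ⊕1⊕1 x = trans (⊕-assoc x 1E 1E) (trans (cong (x ⊕_) (⊕-self 1E)) (⊕-identityʳ x))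
      ⊕1E-↭ : map (_⊕ 1E) (allElts n) ↭ allElts n
      ⊕1E-↭ = map-inverse-↭ (allElts-unique n) (_⊕ 1E) (_⊕ 1E) ⊕1⊕1 ⊕1⊕1
                (λ _ → allElts-complete n _) (λ _ → allElts-complete n _)
      flip : ∀ x → χ (x ⊕ 1E) ≡ - χ x
      flip x = begin
        χ (x ⊕ 1E)      ≡⟨ χ-⊕ x 1E ⟩
        χ x * χ 1E      ≡⟨ cong (χ x *_) (χ-trace-1E trace-1E) ⟩
        χ x * - + 1     ≡⟨ sym (ℤₚ.neg-distribʳ-* (χ x) (+ 1)) ⟩
        - (χ x * + 1)   ≡⟨ cong -_ (ℤₚ.*-identityʳ (χ x)) ⟩
        - χ x           ∎

    orthogonality : ∀ y → ∑[ b ∈ allElts n ] χ (b · y) ≡ indicator (y ≟E 0E) (+ (2 ℕ.^ n))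
    orthogonality y with y ≟E 0E
    ... | yes refl = trans (∑-cong (λ b → trans (cong χ (·-zeroʳ b)) χ-0E) (allElts n)) (∑-1-allElts n)
    ... | no y≢0 = begin
      ∑[ b ∈ allElts n ] χ (b · y)    ≡⟨ ∑-cong (λ b → cong χ (·-comm b y)) (allElts n) ⟩
      ∑[ b ∈ allElts n ] χ (y · b)    ≡⟨ ∑-permute (y ·_) χ (map-·-allElts↭ y≢0) ⟩
      ∑ (allElts n) χ                 ≡⟨ ∑-χ ⟩
      + 0                             ∎
      where open ≡-Reasoning

    module _ (f : F → F) where

      W-at-0E : ∀ b → W p f b 0E ≡ ∑[ x ∈ allElts n ] χ (b · f x)
      W-at-0E b = ∑-cong (λ x → cong χ (trans (cong ((b · f x) ⊕_) (·-zeroˡ x)) (⊕-identityʳ _))) (allElts n)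

      W-0E-0E : W p f 0E 0E ≡ + (2 ℕ.^ n)
      W-0E-0E = trans (W-at-0E 0E) (trans (∑-cong (λ x → trans (cong χ (·-zeroˡ (f x))) χ-0E) (allElts n)) (∑-1-allElts n))

      ∑-W : ∑[ b ∈ allElts n ] W p f b 0E ≡ + (2 ℕ.^ n) * + ω0 f
      ∑-W = begin
        ∑[ b ∈ allElts n ] W p f b 0E
          ≡⟨ ∑-cong W-at-0E (allElts n) ⟩
        ∑[ b ∈ allElts n ] ∑[ x ∈ allElts n ] χ (b · f x)
          ≡⟨ ∑-swap (λ b x → χ (b · f x)) (allElts n) (allElts n) ⟩
        ∑[ x ∈ allElts n ] ∑[ b ∈ allElts n ] χ (b · f x)
          ≡⟨ ∑-cong (λ x → orthogonality (f x)) (allElts n) ⟩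
        ∑[ x ∈ allElts n ] indicator (f x ≟E 0E) (+ (2 ℕ.^ n))
          ≡⟨ ∑-indicator (λ x → f x ≟E 0E) (+ (2 ℕ.^ n)) (allElts n) ⟩
        + (2 ℕ.^ n) * + ω0 f
          ∎
        where open ≡-Reasoning

      W²-at-0E : ∀ b → W p f b 0E * W p f b 0E ≡ ∑[ x ∈ allElts n ] ∑[ y ∈ allElts n ] χ (b · (f x ⊕ f y))
      W²-at-0E b = begin
        W p f b 0E * W p f b 0E
          ≡⟨ cong₂ _*_ (W-at-0E b) (W-at-0E b) ⟩
        (∑[ x ∈ allElts n ] χ (b · f x)) * (∑[ y ∈ allElts n ] χ (b · f y))
          ≡⟨ ∑-* _ (λ x → χ (b · f x)) (allElts n) ⟩
        ∑[ x ∈ allElts n ] χ (b · f x) * (∑[ y ∈ allElts n ] χ (b · f y))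
          ≡⟨ ∑-cong (λ x → *-∑ (χ (b · f x)) (λ y → χ (b · f y)) (allElts n)) (allElts n) ⟩
        ∑[ x ∈ allElts n ] ∑[ y ∈ allElts n ] χ (b · f x) * χ (b · f y)
          ≡⟨ ∑-cong (λ x → ∑-cong (χ-·-⊕ x) (allElts n)) (allElts n) ⟩
        ∑[ x ∈ allElts n ] ∑[ y ∈ allElts n ] χ (b · (f x ⊕ f y))
          ∎
        where
        open ≡-Reasoning
        χ-·-⊕ : ∀ x y → χ (b · f x) * χ (b · f y) ≡ χ (b · (f x ⊕ f y))
        χ-·-⊕ x y = sym (trans (cong χ (·-distribˡ b (f x) (f y))) (χ-⊕ (b · f x) (b · f y)))

      ∑-W² : ∑[ b ∈ allElts n ] W p f b 0E * W p f b 0E ≡ + (2 ℕ.^ n) * + Nf f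
      ∑-W² = begin
        ∑[ b ∈ allElts n ] W p f b 0E * W p f b 0E
          ≡⟨ ∑-cong W²-at-0E (allElts n) ⟩
        ∑[ b ∈ allElts n ] ∑[ x ∈ allElts n ] ∑[ y ∈ allElts n ] χ (b · (f x ⊕ f y))
          ≡⟨ ∑-swap (λ b x → ∑[ y ∈ allElts n ] χ (b · (f x ⊕ f y))) (allElts n) (allElts n) ⟩
        ∑[ x ∈ allElts n ] ∑[ b ∈ allElts n ] ∑[ y ∈ allElts n ] χ (b · (f x ⊕ f y))
          ≡⟨ ∑-cong (λ x → ∑-swap (λ b y → χ (b · (f x ⊕ f y))) (allElts n) (allElts n)) (allElts n) ⟩
        ∑[ x ∈ allElts n ] ∑[ y ∈ allElts n ] ∑[ b ∈ allElts n ] χ (b · (f x ⊕ f y))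
          ≡⟨ ∑-cong (λ x → ∑-cong (orthogonality-⊕ x) (allElts n)) (allElts n) ⟩
        ∑[ x ∈ allElts n ] ∑[ y ∈ allElts n ] indicator (f x ≟E f y) (+ (2 ℕ.^ n))
          ≡⟨ ∑-cong (λ x → ∑-indicator (λ y → f x ≟E f y) (+ (2 ℕ.^ n)) (allElts n)) (allElts n) ⟩
        ∑[ x ∈ allElts n ] + (2 ℕ.^ n) * + length (filter (λ y → f x ≟E f y) (allElts n))
          ≡⟨ sym (*-∑ (+ (2 ℕ.^ n)) (λ x → + length (filter (λ y → f x ≟E f y) (allElts n))) (allElts n)) ⟩
        + (2 ℕ.^ n) * (∑[ x ∈ allElts n ] + length (filter (λ y → f x ≟E f y) (allElts n)))
          ≡⟨ cong (+ (2 ℕ.^ n) *_) (sym (length-concatMap (λ x → filter (λ y → f x ≟E f y) (allElts n)) (allElts n))) ⟩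
        + (2 ℕ.^ n) * + Nf f
          ∎
        where
        open ≡-Reasoning
        orthogonality-⊕ : ∀ x y → ∑[ b ∈ allElts n ] χ (b · (f x ⊕ f y)) ≡ indicator (f x ≟E f y) (+ (2 ℕ.^ n))
        orthogonality-⊕ x y = trans (orthogonality (f x ⊕ f y)) (indicator-⊕≟0E (f x) (f y) (+ (2 ℕ.^ n)))

      counting-equations : ∀ {t} → t ≢ + 0 → ThreeValued (λ b → W p f b 0E) t (nonzeroElts n) →
          + (2 ℕ.^ n) ≡ + 1 + (+ countW p f (+ 0) + + countW p f t + + countW p f (- t))
        × + (2 ℕ.^ n) * + ω0 f ≡ + (2 ℕ.^ n) + t * (+ countW p f t - + countW p f (- t))
        × + (2 ℕ.^ n) * + Nf f ≡ + (2 ℕ.^ n) * + (2 ℕ.^ n) + t * t * (+ countW p f t + + countW p f (- t))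
      counting-equations {t} t≢0 three-valued
        with three-valued-counts (λ b → W p f b 0E) t t≢0 (nonzeroElts n) three-valued
      ... | #nonzero , ∑-nonzero , ∑²-nonzero = cardinality , first-moment , second-moment
        where
        open ≡-Reasoning
        Wf : F → ℤ
        Wf b = W p f b 0E

        split-0E : ∀ h → ∑ (allElts n) h ≡ h 0E + ∑ (nonzeroElts n) h
        split-0E h = sumℤ-↭ (Perm.map⁺ h (allElts↭0E∷nonzeroElts n))

        cardinality : + (2 ℕ.^ n) ≡ + 1 + (+ countW p f (+ 0) + + countW p f t + + countW p f (- t))
        cardinality = begin
          + (2 ℕ.^ n)                    ≡⟨ cong +_ (sym (suc-length-nonzeroElts n)) ⟩
          + suc (length (nonzeroElts n)) ≡⟨ cong (λ l → + suc l) #nonzero ⟩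
          + 1 + + (countW p f (+ 0) ℕ.+ countW p f t ℕ.+ countW p f (- t))
            ≡⟨ cong (_+_ (+ 1)) (trans (ℤₚ.pos-+ (countW p f (+ 0) ℕ.+ countW p f t) _)
                                       (cong (_+ + countW p f (- t)) (ℤₚ.pos-+ (countW p f (+ 0)) _))) ⟩
          + 1 + (+ countW p f (+ 0) + + countW p f t + + countW p f (- t)) ∎

        first-moment : + (2 ℕ.^ n) * + ω0 f ≡ + (2 ℕ.^ n) + t * (+ countW p f t - + countW p f (- t))
        first-moment = begin
          + (2 ℕ.^ n) * + ω0 f          ≡⟨ sym ∑-W ⟩
          ∑ (allElts n) Wf              ≡⟨ split-0E Wf ⟩
          Wf 0E + ∑ (nonzeroElts n) Wf  ≡⟨ cong₂ _+_ W-0E-0E ∑-nonzero ⟩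
          + (2 ℕ.^ n) + t * (+ countW p f t - + countW p f (- t)) ∎

        second-moment : + (2 ℕ.^ n) * + Nf f ≡ + (2 ℕ.^ n) * + (2 ℕ.^ n) + t * t * (+ countW p f t + + countW p f (- t))
        second-moment = begin
          + (2 ℕ.^ n) * + Nf f                                  ≡⟨ sym ∑-W² ⟩
          ∑[ b ∈ allElts n ] Wf b * Wf b                        ≡⟨ split-0E (λ b → Wf b * Wf b) ⟩
          Wf 0E * Wf 0E + (∑[ b ∈ nonzeroElts n ] Wf b * Wf b)  ≡⟨ cong₂ _+_ (cong₂ _*_ W-0E-0E W-0E-0E) ∑²-nonzero ⟩
          + (2 ℕ.^ n) * + (2 ℕ.^ n) + t * t * (+ countW p f t + + countW p f (- t)) ∎

-- With N = 2K² = #F and T = 2K = 2^((n+1)/2): the two moment equations determine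
-- a₊ - a₋ and a₊ + a₋, and the cardinality equation then determines a₀.
value-counts-from-moments : ∀ (K : ℤ) .{{_ : ℤ.NonZero K}} {N T} (a₀ a₊ a₋ ν ω : ℤ) →
  N ≡ + 2 * K * K → T ≡ + 2 * K →
  N ≡ + 1 + (a₀ + a₊ + a₋) →
  N * ω ≡ N + T * (a₊ - a₋) →
  N * ν ≡ N * N + T * T * (a₊ + a₋) →
    (+ 2 * a₀ ≡ + 2 * (N - + 1) + N - ν)
  × (+ 4 * a₊ ≡ ν - N + T * (ω - + 1))
  × (+ 4 * a₋ ≡ ν - N - T * (ω - + 1))
value-counts-from-moments K a₀ a₊ a₋ ν ω refl refl cardinality first-moment second-moment =
  zero-count , plus-count , minus-count
  where
  open ≡-Reasoning

  difference : a₊ - a₋ ≡ K * (ω - + 1)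
  difference = ℤₚ.*-cancelˡ-≡ K _ _ (ℤₚ.*-cancelˡ-≡ (+ 2) _ _ (begin
    + 2 * (K * (a₊ - a₋))                                   ≡⟨ solve (K List.∷ a₊ List.∷ a₋ List.∷ List.[]) ⟩
    + 2 * K * K + + 2 * K * (a₊ - a₋) - + 2 * K * K         ≡⟨ cong (_- + 2 * K * K) (sym first-moment) ⟩
    + 2 * K * K * ω - + 2 * K * K                           ≡⟨ solve (K List.∷ ω List.∷ List.[]) ⟩
    + 2 * (K * (K * (ω - + 1)))                             ∎))

  sum : + 2 * (a₊ + a₋) ≡ ν - + 2 * K * K
  sum = ℤₚ.*-cancelˡ-≡ K _ _ (ℤₚ.*-cancelˡ-≡ K _ _ (ℤₚ.*-cancelˡ-≡ (+ 2) _ _ (begin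
    + 2 * (K * (K * (+ 2 * (a₊ + a₋))))
      ≡⟨ solve (K List.∷ a₊ List.∷ a₋ List.∷ List.[]) ⟩
    + 2 * K * K * (+ 2 * K * K) + + 2 * K * (+ 2 * K) * (a₊ + a₋) - + 2 * K * K * (+ 2 * K * K)
      ≡⟨ cong (_- + 2 * K * K * (+ 2 * K * K)) (sym second-moment) ⟩
    + 2 * K * K * ν - + 2 * K * K * (+ 2 * K * K)
      ≡⟨ solve (K List.∷ ν List.∷ List.[]) ⟩
    + 2 * (K * (K * (ν - + 2 * K * K)))
      ∎)))

  zero-count : + 2 * a₀ ≡ + 2 * (+ 2 * K * K - + 1) + + 2 * K * K - ν
  zero-count = begin
    + 2 * a₀                                              ≡⟨ solve (a₀ List.∷ a₊ List.∷ a₋ List.∷ List.[]) ⟩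
    + 2 * (+ 1 + (a₀ + a₊ + a₋)) - + 2 - + 2 * (a₊ + a₋)  ≡⟨ cong₂ (λ u v → + 2 * u - + 2 - v) (sym cardinality) sum ⟩
    + 2 * (+ 2 * K * K) - + 2 - (ν - + 2 * K * K)         ≡⟨ solve (K List.∷ ν List.∷ List.[]) ⟩
    + 2 * (+ 2 * K * K - + 1) + + 2 * K * K - ν           ∎

  plus-count : + 4 * a₊ ≡ ν - + 2 * K * K + + 2 * K * (ω - + 1)
  plus-count = begin
    + 4 * a₊                                  ≡⟨ solve (a₊ List.∷ a₋ List.∷ List.[]) ⟩
    + 2 * (a₊ + a₋) + + 2 * (a₊ - a₋)         ≡⟨ cong₂ (λ u v → u + + 2 * v) sum difference ⟩
    ν - + 2 * K * K + + 2 * (K * (ω - + 1))   ≡⟨ solve (K List.∷ ν List.∷ ω List.∷ List.[]) ⟩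
    ν - + 2 * K * K + + 2 * K * (ω - + 1)     ∎

  minus-count : + 4 * a₋ ≡ ν - + 2 * K * K - + 2 * K * (ω - + 1)
  minus-count = begin
    + 4 * a₋                                  ≡⟨ solve (a₊ List.∷ a₋ List.∷ List.[]) ⟩
    + 2 * (a₊ + a₋) - + 2 * (a₊ - a₋)         ≡⟨ cong₂ (λ u v → u - + 2 * v) sum difference ⟩
    ν - + 2 * K * K - + 2 * (K * (ω - + 1))   ≡⟨ solve (K List.∷ ν List.∷ ω List.∷ List.[]) ⟩
    ν - + 2 * K * K - + 2 * K * (ω - + 1)     ∎

2^odd≡2*2^k*2^k : ∀ k → + (2 ℕ.^ suc (2 ℕ.* k)) ≡ + 2 * + (2 ℕ.^ k) * + (2 ℕ.^ k)
2^odd≡2*2^k*2^k k = begin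
  + (2 ℕ.* 2 ℕ.^ (k ℕ.+ (k ℕ.+ 0)))      ≡⟨ cong (λ j → + (2 ℕ.* 2 ℕ.^ (k ℕ.+ j))) (ℕₚ.+-identityʳ k) ⟩
  + (2 ℕ.* 2 ℕ.^ (k ℕ.+ k))              ≡⟨ cong (λ e → + (2 ℕ.* e)) (ℕₚ.^-distribˡ-+-* 2 k k) ⟩
  + (2 ℕ.* (2 ℕ.^ k ℕ.* 2 ℕ.^ k))        ≡⟨ cong +_ (sym (ℕₚ.*-assoc 2 (2 ℕ.^ k) _)) ⟩
  + (2 ℕ.* 2 ℕ.^ k ℕ.* 2 ℕ.^ k)          ≡⟨ ℤₚ.pos-* (2 ℕ.* 2 ℕ.^ k) _ ⟩
  + (2 ℕ.* 2 ℕ.^ k) * + (2 ℕ.^ k)        ≡⟨ cong (_* + (2 ℕ.^ k)) (ℤₚ.pos-* 2 (2 ℕ.^ k)) ⟩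
  + 2 * + (2 ℕ.^ k) * + (2 ℕ.^ k)        ∎
  where open ≡-Reasoning

lemma6p9 : (k : ℕ) (p : Vec Bool (suc (2 ℕ.* k))) → IsField p →
    (f : Elt (suc (2 ℕ.* k)) → Elt (suc (2 ℕ.* k))) → AlmostBent k p f →
    ((+ 2) * (+ countW p f (+ 0)) ≡ (+ 2) * ((+ (2 ℕ.^ suc (2 ℕ.* k))) - + 1) + (+ (2 ℕ.^ suc (2 ℕ.* k))) - (+ Nf f))
    × ((+ 4) * (+ countW p f (+ (2 ℕ.^ suc k))) ≡ (+ Nf f) - (+ (2 ℕ.^ suc (2 ℕ.* k))) + (+ (2 ℕ.^ suc k)) * ((+ ω0 f) - + 1))
    × ((+ 4) * (+ countW p f (- (+ (2 ℕ.^ suc k)))) ≡ (+ Nf f) - (+ (2 ℕ.^ suc (2 ℕ.* k))) - (+ (2 ℕ.^ suc k)) * ((+ ω0 f) - + 1))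
lemma6p9 k p isField f almostBent =
  let cardinality , first-moment , second-moment =
        counting-equations (trace-1E-odd k p) f 2^suc-k≢0 almost-bent-at-0E
  in value-counts-from-moments (+ (2 ℕ.^ k)) {{ℕₚ.m^n≢0 2 k}}
       (+ countW p f (+ 0)) (+ countW p f (+ (2 ℕ.^ suc k))) (+ countW p f (- + (2 ℕ.^ suc k))) (+ Nf f) (+ ω0 f)
       (2^odd≡2*2^k*2^k k) (ℤₚ.pos-* 2 (2 ℕ.^ k)) cardinality first-moment second-moment
  where
  open FiniteField p isField

  2^suc-k≢0 : + (2 ℕ.^ suc k) ≢ + 0
  2^suc-k≢0 eq = ℕ.≢-nonZero⁻¹ _ {{ℕₚ.m^n≢0 2 (suc k)}} (ℤₚ.+-injective eq)

  almost-bent-at-0E : ThreeValued (λ b → W p f b 0E) (+ (2 ℕ.^ suc k)) (nonzeroElts (suc (2 ℕ.* k)))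
  almost-bent-at-0E = All.tabulate (λ b∈ → almostBent _ (∈-nonzeroElts⁻ _ b∈) 0E)
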